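{- For every non-negative integer $n$ the following three identities hold: \[ \sum_{k=0}^{n}s(n,k)\,B_{k}=\frac{(-1)^{n}\,n!}{n+1}, \] \[ \sum_{k=0}^{n}s(n,k)\,\frac{(2^{ -k}-2)\,B_{k+1}}{k+1}=\frac{(-1)^{n}}{n+1}\cdot \frac{1\cdot 3 \cdot 5 \cdots (2n-1)}{2^{n+1}}, \] and \[ \sum_{k=0}^{n}s(n,k)\cdot \frac{\bigl(1+2^{ -(k+1)}(1-2^{ -k})\bigr)B_{k+1}+4^{ -(k+1)}(k+1)E_{k}}{k+1}= \frac{(-1)^{n-1}}{4(n+1)}\cdot \left(\frac{3}{4}\right)^{(n)}. \]
   Context: The Stirling numbers of the first kind $s(n,k)$ ($0\le k\le n$) are defined by $(x)_n=\sum_{k=0}^n s(n,k)x^k$, where $(x)_n=x(x-1)\cdots(x-n+1)$ is the falling factorial (with $(x)_0=1$, so $s(0,0)=1$). The Bernoulli numbers $B_n$ are defined by $\frac{t}{e^t-1}=\sum_{n\ge 0}B_n\frac{t^n}{n!}$ for $|t|<2\pi$ (so $B_0=1$, $B_1=-\tfrac12$). The Euler numbers $E_n$ are defined by $\frac{1}{\cosh t}=\frac{2}{e^t+e^{ -t}}=\sum_{n\ge 0}E_n\frac{t^n}{n!}$. For real $x$, $x^{(n)}=x(x+1)\cdots(x+n-1)$ denotes the rising factorial (with $x^{(0)}=1$). The product $1\cdot 3\cdot 5\cdots(2n-1)$ is the product of the first $n$ odd positive integers, equal to $1$ when $n=0$. -}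

module Defs where

open import Data.Nat as ℕ using (ℕ; zero; suc; _≤?_)
open import Data.Nat.Combinatorics using (_C_)
open import Data.Integer as ℤ using (ℤ; +_)
open import Data.Rational as ℚ using (ℚ; _+_; _*_; -_; _/_; 0ℚ; 1ℚ)
open import Data.Bool using (if_then_else_)
open import Relation.Nullary.Decidable using (does)

ι : ℕ → ℚ
ι n = + n / 1

sumTo : ℕ → (ℕ → ℚ) → ℚ
sumTo zero    f = f 0
sumTo (suc n) f = sumTo n f + f (suc n)

pow : ℚ → ℕ → ℚ
pow q zero    = 1ℚ
pow q (suc n) = q * pow q n

sgn : ℕ → ℚ
sgn n = pow (- 1ℚ) n

halfPow : ℕ → ℚ
halfPow k = pow ℚ.½ k

-- Signed Stirling numbers of the first kind: s(n,k) is the coefficient of x^k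
-- in (x)_n = x(x-1)...(x-n+1); since (x)_{n+1} = (x)_n · (x - n),
-- coefficients satisfy s(n+1,k+1) = s(n,k) - n·s(n,k+1), s(n+1,0) = 0.
stirling1 : ℕ → ℕ → ℤ
stirling1 zero    zero    = + 1
stirling1 zero    (suc k) = + 0
stirling1 (suc n) zero    = + 0
stirling1 (suc n) (suc k) = stirling1 n k ℤ.- (+ n) ℤ.* stirling1 n (suc k)

-- Bernoulli numbers (t/(e^t-1) convention, B_1 = -1/2), computed via the
-- coefficient identity of (e^t - 1)·(t/(e^t-1)) = t:
-- B_0 = 1, Σ_{j=0}^{m} C(m+1,j) B_j = 0 for m ≥ 1.
-- bernUpTo n j = B_j for all j ≤ n.
bernUpTo : ℕ → ℕ → ℚ
bernUpTo zero    = λ _ → 1ℚ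
bernUpTo (suc n) j =
  if does (j ≤? n) then bernUpTo n j
  else - ((+ 1 / suc (suc n)) * sumTo n (λ i → ι (suc (suc n) C i) * bernUpTo n i))

bernoulli : ℕ → ℚ
bernoulli n = bernUpTo n n

-- Euler numbers (1/cosh t = Σ E_n t^n/n!), computed via the coefficient
-- identity of cosh t · (1/cosh t) = 1:
-- E_0 = 1, Σ_{j=0}^{m} C(m,j) [m-j even] E_j = 0 for m ≥ 1.
evenInd : ℕ → ℚ
evenInd zero          = 1ℚ
evenInd (suc zero)    = 0ℚ
evenInd (suc (suc m)) = evenInd m

eulerUpTo : ℕ → ℕ → ℚ
eulerUpTo zero    = λ _ → 1ℚ
eulerUpTo (suc n) j =
  if does (j ≤? n) then eulerUpTo n j
  else - sumTo n (λ i → ι (suc n C i) * evenInd (suc n ℕ.∸ i) * eulerUpTo n i)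

euler : ℕ → ℚ
euler n = eulerUpTo n n

oddProd : ℕ → ℕ
oddProd zero    = 1
oddProd (suc n) = oddProd n ℕ.* suc (2 ℕ.* n)

rising : ℚ → ℕ → ℚ
rising x zero    = 1ℚ
rising x (suc n) = rising x n * (x + ι n)

s : ℕ → ℕ → ℚ
s n k = stirling1 n k / 1

-- A sequence c is read as the linear functional L_c on polynomials with
-- L_c(xᵏ) = c_k, so that Σₖ s(n,k) c_k = L_c((x)ₙ)  ('stirlingSum n c').
-- 'translate r c' is the sequence m ↦ L_c((x+r)ᵐ) = Σⱼ C(m,j) r^(m-j) c_j,
-- i.e. multiplication of the exponential generating function by e^(rt).
-- Because (x+1)_(n+1) − (x)_(n+1) = (n+1)·(x)ₙ, we get the DIFFERENCE LEMMA:
--   if  translate 1 c = c + e  then  Σₖ s(n,k) c_k = Σₖ s(n+1,k) e_k / (n+1).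
-- The three identities are this lemma for c = B, c₂, c₃ (the summands of the
-- statement) with e = δ₁, (½)ᵏ − δ₀ and δ₀ − (¼)ᵏ, together with the values
-- Σ s(n+1,k)δ₁(k) = (−1)ⁿ n!, Σ s(n+1,k)δ₀(k) = 0 and Σ s(n,k) rᵏ = (r)ₙ.
-- The translation rules for B and E are their defining recurrences
-- ((eᵗ−1)B(t) = t and (eᵗ+e⁻ᵗ)E(t) = 2).  As c₂ and c₃ divide by k+1, their
-- rules are proved after multiplying by the index ('timesT': multiplication
-- of the generating function by t), which commutes with translation.

module Submission where

open import Defs
open import Data.Nat as ℕ using (ℕ; zero; suc; _!; _∸_; _≤_; _<_; z≤n; s≤s)
import Data.Nat.Properties as ℕP
open import Data.Nat.Combinatorics
  using (_C_; nCk+nC[k+1]≡[n+1]C[k+1]; nCn≡1; nC1≡n; nCk≡nC[n∸k]; k>n⇒nCk≡0)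
open import Data.Integer as ℤ using (ℤ; +_)
import Data.Integer.Properties as ℤP
import Data.Integer.Tactic.RingSolver as ℤ-Solver
import Data.Nat.Tactic.RingSolver as ℕ-Solver
open import Data.Rational as ℚ using (ℚ; _*_; _+_; _-_; -_; _/_; 1ℚ; 0ℚ; ½)
import Data.Rational.Properties as ℚP
import Data.Rational.Unnormalised as ℚᵘ
import Data.Rational.Unnormalised.Properties as ℚᵘP
open import Data.Rational.Solver using (module +-*-Solver)
open import Algebra.Properties.Group ℚP.+-0-group using () renaming (∙-cancelˡ to +-cancelˡ)
open import Data.List.Base using (_∷_; [])
open import Data.Product using (_×_; _,_)
open import Data.Sum using (inj₁; inj₂)
open import Relation.Nullary.Decidable using (does; dec-true; dec-false)
open import Data.Bool using (if_then_else_)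
open import Relation.Binary.PropositionalEquality
open +-*-Solver
open ≡-Reasoning

fromℤ : ℤ → ℚ
fromℤ i = i / 1

equal-via-ℚᵘ : ∀ {p q : ℚ} (u : ℚᵘ.ℚᵘ) → ℚ.toℚᵘ p ℚᵘ.≃ u → ℚ.toℚᵘ q ℚᵘ.≃ u → p ≡ q
equal-via-ℚᵘ u p≃u q≃u = ℚP.toℚᵘ-injective (ℚᵘP.≃-trans p≃u (ℚᵘP.≃-sym q≃u))

toℚᵘ-fromℤ : ∀ i → ℚ.toℚᵘ (fromℤ i) ℚᵘ.≃ ℚᵘ.mkℚᵘ i 0
toℚᵘ-fromℤ i = ℚP.toℚᵘ-fromℚᵘ (ℚᵘ.mkℚᵘ i 0)

fromℤ-+ : ∀ i j → fromℤ (i ℤ.+ j) ≡ fromℤ i + fromℤ j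
fromℤ-+ i j = equal-via-ℚᵘ (ℚᵘ.mkℚᵘ i 0 ℚᵘ.+ ℚᵘ.mkℚᵘ j 0)
  (ℚᵘP.≃-trans (toℚᵘ-fromℤ (i ℤ.+ j)) (ℚᵘ.*≡* (cross-multiplied i j)))
  (ℚᵘP.≃-trans (ℚP.toℚᵘ-homo-+ (fromℤ i) (fromℤ j)) (ℚᵘP.+-cong (toℚᵘ-fromℤ i) (toℚᵘ-fromℤ j)))
  where
  cross-multiplied : ∀ i j → (i ℤ.+ j) ℤ.* + 1 ≡ (i ℤ.* + 1 ℤ.+ j ℤ.* + 1) ℤ.* + 1
  cross-multiplied = ℤ-Solver.solve-∀

fromℤ-* : ∀ i j → fromℤ (i ℤ.* j) ≡ fromℤ i * fromℤ j
fromℤ-* i j = equal-via-ℚᵘ (ℚᵘ.mkℚᵘ i 0 ℚᵘ.* ℚᵘ.mkℚᵘ j 0)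
  (ℚᵘP.≃-trans (toℚᵘ-fromℤ (i ℤ.* j)) (ℚᵘ.*≡* refl))
  (ℚᵘP.≃-trans (ℚP.toℚᵘ-homo-* (fromℤ i) (fromℤ j)) (ℚᵘP.*-cong (toℚᵘ-fromℤ i) (toℚᵘ-fromℤ j)))

fromℤ-neg : ∀ i → fromℤ (ℤ.- i) ≡ - fromℤ i
fromℤ-neg i = equal-via-ℚᵘ (ℚᵘ.- ℚᵘ.mkℚᵘ i 0)
  (toℚᵘ-fromℤ (ℤ.- i))
  (ℚᵘP.≃-trans (ℚP.toℚᵘ-homo‿- (fromℤ i)) (ℚᵘP.-‿cong (toℚᵘ-fromℤ i)))

ι-suc : ∀ n → ι (suc n) ≡ 1ℚ + ι n
ι-suc n = fromℤ-+ (+ 1) (+ n)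

ι-* : ∀ m n → ι (m ℕ.* n) ≡ ι m * ι n
ι-* m n = trans (cong fromℤ (ℤP.pos-* m n)) (fromℤ-* (+ m) (+ n))

ι-+ : ∀ m n → ι (m ℕ.+ n) ≡ ι m + ι n
ι-+ m n = trans (cong fromℤ (ℤP.pos-+ m n)) (fromℤ-+ (+ m) (+ n))

ι-inverse : ∀ n → ι (suc n) * (+ 1 / suc n) ≡ 1ℚ
ι-inverse n = equal-via-ℚᵘ ℚᵘ.1ℚᵘ
  (ℚᵘP.≃-trans (ℚP.toℚᵘ-homo-* (ι (suc n)) (+ 1 / suc n))
    (ℚᵘP.≃-trans (ℚᵘP.*-cong (toℚᵘ-fromℤ (+ suc n)) (ℚP.toℚᵘ-fromℚᵘ (ℚᵘ.mkℚᵘ (+ 1) n)))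
      (ℚᵘ.*≡* (cross-multiplied n))))
  ℚᵘP.≃-refl
  where
  cross-multiplied : ∀ n → (+ suc n ℤ.* + 1) ℤ.* + 1 ≡ + 1 ℤ.* + (1 ℕ.* suc n)
  cross-multiplied n = cong +_ (ℕ-Solver.solve (n ∷ []))

divide-by-suc : ∀ n {x y} → ι (suc n) * x ≡ y → x ≡ y * (+ 1 / suc n)
divide-by-suc n {x} {y} nx≡y = begin
  x                                  ≡⟨ sym (ℚP.*-identityʳ x) ⟩
  x * 1ℚ                             ≡⟨ cong (x *_) (sym (ι-inverse n)) ⟩
  x * (ι (suc n) * (+ 1 / suc n))    ≡⟨ solve 3 (λ x a b → x :* (a :* b) := (a :* x) :* b) refl x (ι (suc n)) (+ 1 / suc n) ⟩
  (ι (suc n) * x) * (+ 1 / suc n)    ≡⟨ cong (_* (+ 1 / suc n)) nx≡y ⟩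
  y * (+ 1 / suc n)                  ∎

ι-cancel : ∀ n {x y} → ι (suc n) * x ≡ ι (suc n) * y → x ≡ y
ι-cancel n {x} {y} eq = begin
  x                                  ≡⟨ divide-by-suc n eq ⟩
  ι (suc n) * y * (+ 1 / suc n)      ≡⟨ solve 3 (λ a y b → (a :* y) :* b := y :* (a :* b)) refl (ι (suc n)) y (+ 1 / suc n) ⟩
  y * (ι (suc n) * (+ 1 / suc n))    ≡⟨ cong (y *_) (ι-inverse n) ⟩
  y * 1ℚ                             ≡⟨ ℚP.*-identityʳ y ⟩
  y                                  ∎

pow-* : ∀ a b j → pow a j * pow b j ≡ pow (a * b) j
pow-* a b zero    = refl
pow-* a b (suc j) = begin
  (a * pow a j) * (b * pow b j)  ≡⟨ solve 4 (λ a b x y → (a :* x) :* (b :* y) := (a :* b) :* (x :* y)) refl a b (pow a j) (pow b j) ⟩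
  (a * b) * (pow a j * pow b j)  ≡⟨ cong ((a * b) *_) (pow-* a b j) ⟩
  (a * b) * pow (a * b) j        ∎

pow-1 : ∀ k → pow 1ℚ k ≡ 1ℚ
pow-1 zero    = refl
pow-1 (suc k) = cong (1ℚ *_) (pow-1 k)

Seq : Set
Seq = ℕ → ℚ

_⁺ : Seq → Seq
(d ⁺) k = d (suc k)

sumTo-cong-≤ : ∀ n {f g : Seq} → (∀ k → k ≤ n → f k ≡ g k) → sumTo n f ≡ sumTo n g
sumTo-cong-≤ zero    f≡g = f≡g 0 z≤n
sumTo-cong-≤ (suc n) f≡g =
  cong₂ _+_ (sumTo-cong-≤ n (λ k k≤n → f≡g k (ℕP.m≤n⇒m≤1+n k≤n))) (f≡g (suc n) ℕP.≤-refl)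

sumTo-first : ∀ n (f : Seq) → sumTo (suc n) f ≡ f 0 + sumTo n (f ⁺)
sumTo-first zero    f = refl
sumTo-first (suc n) f = begin
  sumTo (suc n) f + f (suc (suc n))             ≡⟨ cong (_+ f (suc (suc n))) (sumTo-first n f) ⟩
  (f 0 + sumTo n (f ⁺)) + f (suc (suc n))       ≡⟨ ℚP.+-assoc (f 0) _ _ ⟩
  f 0 + sumTo (suc n) (f ⁺)                     ∎

neg-as-scale : ∀ p → (- 1ℚ) * p ≡ - p
neg-as-scale p = solve 1 (λ p → (:- con 1ℚ) :* p := :- p) refl p

record Linear (L : Seq → ℚ) : Set where
  field
    cong-≗      : ∀ {d e} → d ≗ e → L d ≡ L e
    additive    : ∀ d e → L (λ k → d k + e k) ≡ L d + L e
    homogeneous : ∀ a d → L (λ k → a * d k) ≡ a * L d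

  difference : ∀ d e → L (λ k → d k - e k) ≡ L d - L e
  difference d e = begin
    L (λ k → d k - e k)                 ≡⟨ cong-≗ (λ k → cong (λ x → d k + x) (sym (neg-as-scale (e k)))) ⟩
    L (λ k → d k + (- 1ℚ) * e k)        ≡⟨ additive d _ ⟩
    L d + L (λ k → (- 1ℚ) * e k)        ≡⟨ cong (λ x → L d + x) (trans (homogeneous (- 1ℚ) e) (neg-as-scale (L e))) ⟩
    L d - L e                           ∎

  scaled-difference : ∀ a b d e → L (λ k → a * d k - b * e k) ≡ a * L d - b * L e
  scaled-difference a b d e = trans (difference _ _) (cong₂ _-_ (homogeneous a d) (homogeneous b e))

  vanishes : L (λ _ → 0ℚ) ≡ 0ℚ
  vanishes = trans (homogeneous 0ℚ (λ _ → 0ℚ)) (ℚP.*-zeroˡ (L (λ _ → 0ℚ)))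

open Linear

linear-≗ : ∀ {L M : Seq → ℚ} → (∀ d → L d ≡ M d) → Linear M → Linear L
linear-≗ {L} {M} L≡M lin = record
  { cong-≗      = λ {d} {e} d≗e → trans (L≡M d) (trans (cong-≗ lin d≗e) (sym (L≡M e)))
  ; additive    = λ d e → trans (L≡M _) (trans (additive lin d e) (sym (cong₂ _+_ (L≡M d) (L≡M e))))
  ; homogeneous = λ a d → trans (L≡M _) (trans (homogeneous lin a d) (sym (cong (a *_) (L≡M d))))
  }

sumTo-linear : ∀ n → Linear (sumTo n)
sumTo-linear n = record
  { cong-≗      = λ f≗g → sumTo-cong-≤ n (λ k _ → f≗g k)
  ; additive    = additive′ n
  ; homogeneous = homogeneous′ n
  }
  where
  additive′ : ∀ n f g → sumTo n (λ k → f k + g k) ≡ sumTo n f + sumTo n g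
  additive′ zero    f g = refl
  additive′ (suc n) f g = begin
    sumTo n (λ k → f k + g k) + (f (suc n) + g (suc n))
      ≡⟨ cong (_+ (f (suc n) + g (suc n))) (additive′ n f g) ⟩
    (sumTo n f + sumTo n g) + (f (suc n) + g (suc n))
      ≡⟨ solve 4 (λ x y u v → (x :+ y) :+ (u :+ v) := (x :+ u) :+ (y :+ v)) refl (sumTo n f) (sumTo n g) (f (suc n)) (g (suc n)) ⟩
    sumTo (suc n) f + sumTo (suc n) g ∎

  homogeneous′ : ∀ n a f → sumTo n (λ k → a * f k) ≡ a * sumTo n f
  homogeneous′ zero    a f = refl
  homogeneous′ (suc n) a f =
    trans (cong (_+ a * f (suc n)) (homogeneous′ n a f)) (sym (ℚP.*-distribˡ-+ a (sumTo n f) (f (suc n))))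

weighted-linear : ∀ n (w : Seq) → Linear (λ d → sumTo n (λ k → w k * d k))
weighted-linear n w = record
  { cong-≗      = λ d≗e → cong-≗ Σ (λ k → cong (w k *_) (d≗e k))
  ; additive    = λ d e → trans (cong-≗ Σ (λ k → ℚP.*-distribˡ-+ (w k) (d k) (e k))) (additive Σ _ _)
  ; homogeneous = λ a d → trans (cong-≗ Σ (λ k → solve 3 (λ w a x → w :* (a :* x) := a :* (w :* x)) refl (w k) a (d k)))
                                (homogeneous Σ a _)
  }
  where Σ = sumTo-linear n

s-rec : ∀ n k → s (suc n) (suc k) ≡ s n k - ι n * s n (suc k)
s-rec n k = begin
  fromℤ (stirling1 n k ℤ.- + n ℤ.* stirling1 n (suc k))   ≡⟨ fromℤ-+ (stirling1 n k) _ ⟩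
  s n k + fromℤ (ℤ.- (+ n ℤ.* stirling1 n (suc k)))       ≡⟨ cong (λ x → s n k + x) (fromℤ-neg (+ n ℤ.* stirling1 n (suc k))) ⟩
  s n k - fromℤ (+ n ℤ.* stirling1 n (suc k))             ≡⟨ cong (λ x → s n k - x) (fromℤ-* (+ n) _) ⟩
  s n k - ι n * s n (suc k)                               ∎

s-vanish : ∀ n k → n < k → s n k ≡ 0ℚ
s-vanish zero    (suc k) _         = refl
s-vanish (suc n) (suc k) (s≤s n<k) = begin
  s (suc n) (suc k)              ≡⟨ s-rec n k ⟩
  s n k - ι n * s n (suc k)      ≡⟨ cong₂ (λ x y → x - ι n * y) (s-vanish n k n<k) (s-vanish n (suc k) (ℕP.m<n⇒m<1+n n<k)) ⟩
  0ℚ - ι n * 0ℚ                  ≡⟨ solve 1 (λ x → con 0ℚ :- x :* con 0ℚ := con 0ℚ) refl (ι n) ⟩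
  0ℚ                             ∎

stirlingSum : ℕ → Seq → ℚ
stirlingSum n c = sumTo n (λ k → s n k * c k)

stirlingSum-linear : ∀ n → Linear (stirlingSum n)
stirlingSum-linear n = weighted-linear n (s n)

-- Dropping the vanishing terms s(n+1,0) and s(n+1,n+2) from a shifted Stirling sum;
-- for n = 0 the term s(0,0) survives, but it is killed by the factor n below.
upper-sum : ∀ n (c : Seq) → sumTo (suc n) (λ k → s (suc n) (suc k) * c (suc k)) ≡ stirlingSum (suc n) c
upper-sum n c = begin
  X + s (suc n) (suc (suc n)) * c (suc (suc n))
    ≡⟨ cong (λ z → X + z * c (suc (suc n))) (s-vanish (suc n) (suc (suc n)) ℕP.≤-refl) ⟩
  X + 0ℚ * c (suc (suc n))
    ≡⟨ solve 3 (λ x y z → x :+ con 0ℚ :* y := con 0ℚ :* z :+ x) refl X (c (suc (suc n))) (c 0) ⟩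
  0ℚ * c 0 + X
    ≡⟨ sym (sumTo-first n (λ k → s (suc n) k * c k)) ⟩
  stirlingSum (suc n) c ∎
  where X = sumTo n (λ k → s (suc n) (suc k) * c (suc k))

n*upper-sum : ∀ n (c : Seq) → ι n * sumTo n (λ k → s n (suc k) * c (suc k)) ≡ ι n * stirlingSum n c
n*upper-sum zero    c = solve 2 (λ x y → con 0ℚ :* x := con 0ℚ :* y) refl (s 0 1 * c 1) (s 0 0 * c 0)
n*upper-sum (suc n) c = cong (ι (suc n) *_) (upper-sum n c)

-- L_c((x)_(n+1)) = L_c(x·(x)ₙ) − n·L_c((x)ₙ), where L_c(x·p) = L_(c⁺)(p).
stirlingSum-rec : ∀ n (c : Seq) → stirlingSum (suc n) c ≡ stirlingSum n (c ⁺) - ι n * stirlingSum n c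
stirlingSum-rec n c = begin
  stirlingSum (suc n) c
    ≡⟨ sumTo-first n (λ k → s (suc n) k * c k) ⟩
  0ℚ * c 0 + sumTo n (λ k → s (suc n) (suc k) * c (suc k))
    ≡⟨ cong (λ x → 0ℚ * c 0 + x) (cong-≗ (sumTo-linear n) expand) ⟩
  0ℚ * c 0 + sumTo n (λ k → s n k * c (suc k) - ι n * (s n (suc k) * c (suc k)))
    ≡⟨ cong (λ x → 0ℚ * c 0 + x) (difference (sumTo-linear n) _ _) ⟩
  0ℚ * c 0 + (stirlingSum n (c ⁺) - sumTo n (λ k → ι n * (s n (suc k) * c (suc k))))
    ≡⟨ cong (λ x → 0ℚ * c 0 + (stirlingSum n (c ⁺) - x)) (homogeneous (sumTo-linear n) (ι n) _) ⟩
  0ℚ * c 0 + (stirlingSum n (c ⁺) - ι n * R)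
    ≡⟨ solve 3 (λ c₀ x y → con 0ℚ :* c₀ :+ (x :- y) := x :- y) refl (c 0) (stirlingSum n (c ⁺)) (ι n * R) ⟩
  stirlingSum n (c ⁺) - ι n * R
    ≡⟨ cong (λ x → stirlingSum n (c ⁺) - x) (n*upper-sum n c) ⟩
  stirlingSum n (c ⁺) - ι n * stirlingSum n c ∎
  where
  R = sumTo n (λ k → s n (suc k) * c (suc k))
  expand : ∀ k → s (suc n) (suc k) * c (suc k) ≡ s n k * c (suc k) - ι n * (s n (suc k) * c (suc k))
  expand k = trans (cong (_* c (suc k)) (s-rec n k))
    (solve 4 (λ a b i y → (a :- i :* b) :* y := a :* y :- i :* (b :* y)) refl (s n k) (s n (suc k)) (ι n) (c (suc k)))

-- The unit sequences δ₀ = (1,0,0,…), δ₁ = (0,1,0,…) and the geometric sequences rᵏ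
-- (generating functions 1, t and e^(rt)).
δ₀ : Seq
δ₀ zero    = 1ℚ
δ₀ (suc k) = 0ℚ

δ₁ : Seq
δ₁ zero    = 0ℚ
δ₁ (suc k) = δ₀ k

geom : ℚ → Seq
geom r k = pow r k

stirlingSum-δ₀ : ∀ n → stirlingSum (suc n) δ₀ ≡ 0ℚ
stirlingSum-δ₀ zero    = refl
stirlingSum-δ₀ (suc n) = begin
  stirlingSum (suc (suc n)) δ₀
    ≡⟨ stirlingSum-rec (suc n) δ₀ ⟩
  stirlingSum (suc n) (λ _ → 0ℚ) - ι (suc n) * stirlingSum (suc n) δ₀
    ≡⟨ cong₂ (λ x y → x - ι (suc n) * y) (vanishes (stirlingSum-linear (suc n))) (stirlingSum-δ₀ n) ⟩
  0ℚ - ι (suc n) * 0ℚ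
    ≡⟨ solve 1 (λ x → con 0ℚ :- x :* con 0ℚ := con 0ℚ) refl (ι (suc n)) ⟩
  0ℚ ∎

stirlingSum-δ₁ : ∀ n → stirlingSum (suc n) δ₁ ≡ sgn n * ι (n !)
stirlingSum-δ₁ zero    = refl
stirlingSum-δ₁ (suc n) = begin
  stirlingSum (suc (suc n)) δ₁
    ≡⟨ stirlingSum-rec (suc n) δ₁ ⟩
  stirlingSum (suc n) δ₀ - ι (suc n) * stirlingSum (suc n) δ₁
    ≡⟨ cong₂ (λ x y → x - ι (suc n) * y) (stirlingSum-δ₀ n) (stirlingSum-δ₁ n) ⟩
  0ℚ - ι (suc n) * (sgn n * ι (n !))
    ≡⟨ solve 3 (λ a g f → con 0ℚ :- a :* (g :* f) := (:- con 1ℚ :* g) :* (a :* f)) refl (ι (suc n)) (sgn n) (ι (n !)) ⟩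
  sgn (suc n) * (ι (suc n) * ι (n !))
    ≡⟨ cong (sgn (suc n) *_) (sym (ι-* (suc n) (n !))) ⟩
  sgn (suc n) * ι (suc n !) ∎

falling : ℚ → ℕ → ℚ
falling r zero    = 1ℚ
falling r (suc n) = falling r n * (r - ι n)

-- Evaluating (x)ₙ = Σ s(n,k) xᵏ at x = r.
stirlingSum-geom : ∀ r n → stirlingSum n (geom r) ≡ falling r n
stirlingSum-geom r zero    = refl
stirlingSum-geom r (suc n) = begin
  stirlingSum (suc n) (geom r)
    ≡⟨ stirlingSum-rec n (geom r) ⟩
  stirlingSum n (λ k → r * geom r k) - ι n * P
    ≡⟨ cong (_- ι n * P) (homogeneous (stirlingSum-linear n) r (geom r)) ⟩
  r * P - ι n * P
    ≡⟨ cong (λ x → r * x - ι n * x) (stirlingSum-geom r n) ⟩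
  r * falling r n - ι n * falling r n
    ≡⟨ solve 3 (λ r i f → r :* f :- i :* f := f :* (r :- i)) refl r (ι n) (falling r n) ⟩
  falling r (suc n) ∎
  where P = stirlingSum n (geom r)

¼ : ℚ
¼ = + 1 / 4

falling-½ : ∀ n → falling ½ (suc n) ≡ sgn n * (ι (oddProd n) * halfPow (suc n))
falling-½ zero    = refl
falling-½ (suc n) = begin
  falling ½ (suc n) * (½ - ι (suc n))
    ≡⟨ cong₂ (λ x y → x * (½ - y)) (falling-½ n) (ι-suc n) ⟩
  sgn n * (ι (oddProd n) * halfPow (suc n)) * (½ - (1ℚ + ι n))
    ≡⟨ solve 4 (λ m g o h → g :* (o :* h) :* (con ½ :- (con 1ℚ :+ m))
                        := (:- con 1ℚ :* g) :* ((o :* (con 1ℚ :+ con (ι 2) :* m)) :* (con ½ :* h)))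
         refl (ι n) (sgn n) (ι (oddProd n)) (halfPow (suc n)) ⟩
  sgn (suc n) * ((ι (oddProd n) * (1ℚ + ι 2 * ι n)) * halfPow (suc (suc n)))
    ≡⟨ cong (λ x → sgn (suc n) * (x * halfPow (suc (suc n)))) (sym ι-oddProd) ⟩
  sgn (suc n) * (ι (oddProd (suc n)) * halfPow (suc (suc n))) ∎
  where
  ι-oddProd : ι (oddProd (suc n)) ≡ ι (oddProd n) * (1ℚ + ι 2 * ι n)
  ι-oddProd = trans (ι-* (oddProd n) (suc (2 ℕ.* n)))
    (cong (ι (oddProd n) *_) (trans (ι-suc (2 ℕ.* n)) (cong (λ x → 1ℚ + x) (ι-* 2 n))))

falling-¼ : ∀ n → falling ¼ (suc n) ≡ sgn n * ¼ * rising (+ 3 / 4) n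
falling-¼ zero    = refl
falling-¼ (suc n) = begin
  falling ¼ (suc n) * (¼ - ι (suc n))
    ≡⟨ cong₂ (λ x y → x * (¼ - y)) (falling-¼ n) (ι-suc n) ⟩
  sgn n * ¼ * rising (+ 3 / 4) n * (¼ - (1ℚ + ι n))
    ≡⟨ solve 3 (λ m g r → g :* con ¼ :* r :* (con ¼ :- (con 1ℚ :+ m)) := (:- con 1ℚ :* g) :* con ¼ :* (r :* (con (+ 3 / 4) :+ m)))
         refl (ι n) (sgn n) (rising (+ 3 / 4) n) ⟩
  sgn (suc n) * ¼ * rising (+ 3 / 4) (suc n) ∎

-- translate r d m = L_d((x+r)ᵐ), defined through (x+r)^(m+1) = r(x+r)ᵐ + x(x+r)ᵐ.
translate : ℚ → Seq → Seq
translate r d zero    = d 0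
translate r d (suc m) = r * translate r d m + translate r (d ⁺) m

binomial : ℚ → ℕ → ℕ → ℚ
binomial r m j = ι (m C j) * pow r (m ∸ j)

scaled-binomial-sum : ∀ r m (d : Seq) →
  r * sumTo m (λ j → binomial r m j * d j)
    ≡ pow r (suc m) * d 0 + sumTo m (λ j → ι (m C suc j) * pow r (m ∸ j) * d (suc j))
scaled-binomial-sum r m d = begin
  r * sumTo m (λ j → binomial r m j * d j)
    ≡⟨ sym (homogeneous (sumTo-linear m) r _) ⟩
  sumTo m (λ j → r * (binomial r m j * d j))
    ≡⟨ sumTo-cong-≤ m raise ⟩
  sumTo m F
    ≡⟨ sym (trans (cong (λ x → sumTo m F + x) top-vanishes) (ℚP.+-identityʳ (sumTo m F))) ⟩
  sumTo (suc m) F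
    ≡⟨ sumTo-first m F ⟩
  1ℚ * pow r (suc m) * d 0 + sumTo m (F ⁺)
    ≡⟨ cong (_+ sumTo m (F ⁺)) (solve 2 (λ p x → con 1ℚ :* p :* x := p :* x) refl (pow r (suc m)) (d 0)) ⟩
  pow r (suc m) * d 0 + sumTo m (F ⁺) ∎
  where
  F : Seq
  F j = ι (m C j) * pow r (suc m ∸ j) * d j
  raise : ∀ j → j ≤ m → r * (binomial r m j * d j) ≡ F j
  raise j j≤m = trans
    (solve 4 (λ r c p x → r :* (c :* p :* x) := c :* (r :* p) :* x) refl r (ι (m C j)) (pow r (m ∸ j)) (d j))
    (cong (λ e → ι (m C j) * pow r e * d j) (sym (ℕP.+-∸-assoc 1 j≤m)))
  top-vanishes : F (suc m) ≡ 0ℚ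
  top-vanishes = trans (cong (λ c → ι c * pow r (suc m ∸ suc m) * d (suc m)) (k>n⇒nCk≡0 (ℕP.n<1+n m)))
    (solve 2 (λ p x → con 0ℚ :* p :* x := con 0ℚ) refl (pow r (suc m ∸ suc m)) (d (suc m)))

-- The binomial expansion translate r d m = Σⱼ C(m,j) r^(m−j) d_j, by Pascal's rule.
translate-closed : ∀ r m (d : Seq) → translate r d m ≡ sumTo m (λ j → binomial r m j * d j)
translate-closed r zero    d = solve 1 (λ x → x := con 1ℚ :* con 1ℚ :* x) refl (d 0)
translate-closed r (suc m) d = begin
  r * translate r d m + translate r (d ⁺) m
    ≡⟨ cong₂ (λ x y → r * x + y) (translate-closed r m d) (translate-closed r m (d ⁺)) ⟩
  r * sumTo m (λ j → binomial r m j * d j) + Lower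
    ≡⟨ cong (_+ Lower) (scaled-binomial-sum r m d) ⟩
  (pow r (suc m) * d 0 + Upper) + Lower
    ≡⟨ solve 3 (λ x u l → (x :+ u) :+ l := x :+ (l :+ u)) refl (pow r (suc m) * d 0) Upper Lower ⟩
  pow r (suc m) * d 0 + (Lower + Upper)
    ≡⟨ cong (λ x → pow r (suc m) * d 0 + x) (sym (trans (cong-≗ (sumTo-linear m) pascal) (additive (sumTo-linear m) _ _))) ⟩
  pow r (suc m) * d 0 + sumTo m (λ j → binomial r (suc m) (suc j) * d (suc j))
    ≡⟨ cong (_+ sumTo m (λ j → binomial r (suc m) (suc j) * d (suc j)))
         (solve 2 (λ p x → p :* x := con 1ℚ :* p :* x) refl (pow r (suc m)) (d 0)) ⟩
  binomial r (suc m) 0 * d 0 + sumTo m (λ j → binomial r (suc m) (suc j) * d (suc j))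
    ≡⟨ sym (sumTo-first m (λ j → binomial r (suc m) j * d j)) ⟩
  sumTo (suc m) (λ j → binomial r (suc m) j * d j) ∎
  where
  Lower = sumTo m (λ j → binomial r m j * d (suc j))
  Upper = sumTo m (λ j → ι (m C suc j) * pow r (m ∸ j) * d (suc j))
  pascal : ∀ j → binomial r (suc m) (suc j) * d (suc j)
                 ≡ binomial r m j * d (suc j) + ι (m C suc j) * pow r (m ∸ j) * d (suc j)
  pascal j = begin
    ι (suc m C suc j) * pow r (m ∸ j) * d (suc j)
      ≡⟨ cong (λ c → ι c * pow r (m ∸ j) * d (suc j)) (sym (nCk+nC[k+1]≡[n+1]C[k+1] m j)) ⟩
    ι (m C j ℕ.+ m C suc j) * pow r (m ∸ j) * d (suc j)
      ≡⟨ cong (λ c → c * pow r (m ∸ j) * d (suc j)) (ι-+ (m C j) (m C suc j)) ⟩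
    (ι (m C j) + ι (m C suc j)) * pow r (m ∸ j) * d (suc j)
      ≡⟨ solve 4 (λ a b p x → (a :+ b) :* p :* x := a :* p :* x :+ b :* p :* x)
           refl (ι (m C j)) (ι (m C suc j)) (pow r (m ∸ j)) (d (suc j)) ⟩
    binomial r m j * d (suc j) + ι (m C suc j) * pow r (m ∸ j) * d (suc j) ∎

translate-linear : ∀ r m → Linear (λ d → translate r d m)
translate-linear r m = linear-≗ (translate-closed r m) (weighted-linear m (binomial r m))

translate-cong : ∀ r m {d e : Seq} → d ≗ e → translate r d m ≡ translate r e m
translate-cong r m = cong-≗ (translate-linear r m)

translate-zero : ∀ m (d : Seq) → translate 0ℚ d m ≡ d m
translate-zero zero    d = refl
translate-zero (suc m) d = begin
  0ℚ * translate 0ℚ d m + translate 0ℚ (d ⁺) m  ≡⟨ cong (λ x → 0ℚ * translate 0ℚ d m + x) (translate-zero m (d ⁺)) ⟩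
  0ℚ * translate 0ℚ d m + d (suc m)            ≡⟨ solve 2 (λ x y → con 0ℚ :* x :+ y := y) refl (translate 0ℚ d m) (d (suc m)) ⟩
  d (suc m)                                    ∎

-- … and translations compose additively: e^(rt)·e^(qt) = e^((r+q)t).
translate-comp : ∀ r q m (d : Seq) → translate r (translate q d) m ≡ translate (r + q) d m
translate-comp r q zero    d = refl
translate-comp r q (suc m) d = begin
  r * translate r (translate q d) m + translate r (translate q d ⁺) m
    ≡⟨ cong (λ x → r * translate r (translate q d) m + x) unfold-step ⟩
  r * translate r (translate q d) m + (q * translate r (translate q d) m + translate r (translate q (d ⁺)) m)
    ≡⟨ cong₂ (λ x y → r * x + (q * x + y)) (translate-comp r q m d) (translate-comp r q m (d ⁺)) ⟩
  r * X + (q * X + Y)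
    ≡⟨ solve 4 (λ r q x y → r :* x :+ (q :* x :+ y) := (r :+ q) :* x :+ y) refl r q X Y ⟩
  (r + q) * X + Y ∎
  where
  X = translate (r + q) d m
  Y = translate (r + q) (d ⁺) m
  unfold-step : translate r (translate q d ⁺) m
                ≡ q * translate r (translate q d) m + translate r (translate q (d ⁺)) m
  unfold-step = trans (additive (translate-linear r m) _ _)
    (cong (_+ translate r (translate q (d ⁺)) m) (homogeneous (translate-linear r m) q (translate q d)))

translate-δ₀ : ∀ r m → translate r δ₀ m ≡ geom r m
translate-δ₀ r zero    = refl
translate-δ₀ r (suc m) = begin
  r * translate r δ₀ m + translate r (λ _ → 0ℚ) m
    ≡⟨ cong₂ (λ x y → r * x + y) (translate-δ₀ r m) (vanishes (translate-linear r m)) ⟩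
  r * pow r m + 0ℚ
    ≡⟨ ℚP.+-identityʳ (r * pow r m) ⟩
  geom r (suc m) ∎

-- dilate a d = (aᵏ d_k), i.e. the substitution t ↦ a·t in the generating function.
dilate : ℚ → Seq → Seq
dilate a d k = pow a k * d k

-- e^(art)·D(at) is the dilation of e^(rt)·D(t).
translate-dilate : ∀ a r m (d : Seq) → translate (a * r) (dilate a d) m ≡ pow a m * translate r d m
translate-dilate a r zero    d = refl
translate-dilate a r (suc m) d = begin
  (a * r) * translate (a * r) (dilate a d) m + translate (a * r) (dilate a d ⁺) m
    ≡⟨ cong (λ x → (a * r) * translate (a * r) (dilate a d) m + x) shifted ⟩
  (a * r) * translate (a * r) (dilate a d) m + a * translate (a * r) (dilate a (d ⁺)) m
    ≡⟨ cong₂ (λ x y → (a * r) * x + a * y) (translate-dilate a r m d) (translate-dilate a r m (d ⁺)) ⟩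
  (a * r) * (pow a m * translate r d m) + a * (pow a m * translate r (d ⁺) m)
    ≡⟨ solve 5 (λ a r p x y → (a :* r) :* (p :* x) :+ a :* (p :* y) := (a :* p) :* (r :* x :+ y))
         refl a r (pow a m) (translate r d m) (translate r (d ⁺) m) ⟩
  pow a (suc m) * translate r d (suc m) ∎
  where
  shifted : translate (a * r) (dilate a d ⁺) m ≡ a * translate (a * r) (dilate a (d ⁺)) m
  shifted = trans (translate-cong (a * r) m (λ k → ℚP.*-assoc a (pow a k) (d (suc k))))
                  (homogeneous (translate-linear (a * r) m) a (dilate a (d ⁺)))

-- timesT d = (0, 1·d₀, 2·d₁, …), i.e. multiplication of the generating function by t.
timesT : Seq → Seq
timesT d zero    = 0ℚ
timesT d (suc k) = ι (suc k) * d k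

timesT-linear : ∀ m → Linear (λ d → timesT d m)
timesT-linear zero = record
  { cong-≗      = λ _ → refl
  ; additive    = λ _ _ → refl
  ; homogeneous = λ a _ → sym (ℚP.*-zeroʳ a)
  }
timesT-linear (suc m) = record
  { cong-≗      = λ d≗e → cong (ι (suc m) *_) (d≗e m)
  ; additive    = λ d e → ℚP.*-distribˡ-+ (ι (suc m)) (d m) (e m)
  ; homogeneous = λ a d → solve 3 (λ n a x → n :* (a :* x) := a :* (n :* x)) refl (ι (suc m)) a (d m)
  }

-- (k+1)·d_k = d_k + k·d_k, the shift of t·D(t) being D(t) + t·D′(t).
timesT-⁺ : ∀ (d : Seq) k → timesT d (suc k) ≡ d k + timesT (d ⁺) k
timesT-⁺ d zero    = solve 1 (λ x → con 1ℚ :* x := x :+ con 0ℚ) refl (d 0)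
timesT-⁺ d (suc k) = trans (cong (_* d (suc k)) (ι-suc (suc k)))
  (solve 2 (λ n x → (con 1ℚ :+ n) :* x := x :+ n :* x) refl (ι (suc k)) (d (suc k)))

translate-timesT : ∀ r m (d : Seq) → translate r (timesT d) m ≡ timesT (translate r d) m
translate-timesT r zero    d = refl
translate-timesT r (suc m) d = begin
  r * translate r (timesT d) m + translate r (timesT d ⁺) m
    ≡⟨ cong (λ x → r * translate r (timesT d) m + x)
         (trans (translate-cong r m (timesT-⁺ d)) (additive (translate-linear r m) d (timesT (d ⁺)))) ⟩
  r * translate r (timesT d) m + (translate r d m + translate r (timesT (d ⁺)) m)
    ≡⟨ cong₂ (λ x y → r * x + (translate r d m + y)) (translate-timesT r m d) (translate-timesT r m (d ⁺)) ⟩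
  r * timesT (translate r d) m + (translate r d m + timesT (translate r (d ⁺)) m)
    ≡⟨ collect m ⟩
  ι (suc m) * translate r d m ∎
  where
  collect : ∀ m → r * timesT (translate r d) m + (translate r d m + timesT (translate r (d ⁺)) m)
                  ≡ ι (suc m) * translate r d m
  collect zero    = solve 2 (λ r x → r :* con 0ℚ :+ (x :+ con 0ℚ) := con 1ℚ :* x) refl r (d 0)
  collect (suc j) = trans
    (solve 4 (λ r n x y → r :* (n :* x) :+ ((r :* x :+ y) :+ n :* y) := (con 1ℚ :+ n) :* (r :* x :+ y))
       refl r (ι (suc j)) (translate r d j) (translate r (d ⁺) j))
    (cong (_* translate r d (suc j)) (sym (ι-suc (suc j))))

translate-δ₁ : ∀ r m → translate r δ₁ m ≡ timesT (geom r) m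
translate-δ₁ r m = begin
  translate r δ₁ m             ≡⟨ translate-cong r m δ₁-as-timesT ⟩
  translate r (timesT δ₀) m    ≡⟨ translate-timesT r m δ₀ ⟩
  timesT (translate r δ₀) m    ≡⟨ cong-≗ (timesT-linear m) (translate-δ₀ r) ⟩
  timesT (geom r) m            ∎
  where
  δ₁-as-timesT : δ₁ ≗ timesT δ₀
  δ₁-as-timesT zero          = refl
  δ₁-as-timesT (suc zero)    = refl
  δ₁-as-timesT (suc (suc k)) = sym (ℚP.*-zeroʳ (ι (suc (suc k))))

-- Bernoulli and Euler numbers are defined through tables whose row n+1 copies row n
-- below the diagonal and adds a new entry; entries are stable and the new one is the
-- diagonal.
module Tabulated (table : ℕ → ℕ → ℚ) (new : ℕ → ℚ)
  (step : ∀ n j → table (suc n) j ≡ (if does (j ℕ.≤? n) then table n j else new n)) where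

  stable : ∀ n j → j ≤ n → table n j ≡ table j j
  stable zero    zero    z≤n = refl
  stable (suc n) j       j≤1+n with ℕP.m≤n⇒m<n∨m≡n j≤1+n
  ... | inj₂ refl      = refl
  ... | inj₁ (s≤s j≤n) = begin
    table (suc n) j                                       ≡⟨ step n j ⟩
    (if does (j ℕ.≤? n) then table n j else new n)        ≡⟨ cong (if_then table n j else new n) (dec-true (j ℕ.≤? n) j≤n) ⟩
    table n j                                             ≡⟨ stable n j j≤n ⟩
    table j j                                             ∎

  top : ∀ n → table (suc n) (suc n) ≡ new n
  top n = begin
    table (suc n) (suc n)
      ≡⟨ step n (suc n) ⟩
    (if does (suc n ℕ.≤? n) then table n (suc n) else new n)
      ≡⟨ cong (if_then table n (suc n) else new n) (dec-false (suc n ℕ.≤? n) ℕP.1+n≰n) ⟩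
    new n ∎

binomial-1 : ∀ m j → binomial 1ℚ m j ≡ ι (m C j)
binomial-1 m j = trans (cong (ι (m C j) *_) (pow-1 (m ∸ j))) (ℚP.*-identityʳ (ι (m C j)))

binomial-1-top : ∀ m → binomial 1ℚ m m ≡ 1ℚ
binomial-1-top m = trans (binomial-1 m m) (cong ι (nCn≡1 m))

module BernoulliTable = Tabulated bernUpTo
  (λ n → - ((+ 1 / suc (suc n)) * sumTo n (λ i → ι (suc (suc n) C i) * bernUpTo n i)))
  (λ n j → refl)

bernoulli-recurrence : ∀ n → sumTo (suc n) (λ i → ι (suc (suc n) C i) * bernoulli i) ≡ 0ℚ
bernoulli-recurrence n = begin
  X + ι (suc (suc n) C suc n) * bernoulli (suc n)
    ≡⟨ cong₂ (λ c b → X + ι c * b) C[n+2,n+1] (BernoulliTable.top n) ⟩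
  X + ι (suc (suc n)) * (- ((+ 1 / suc (suc n)) * sumTo n (λ i → ι (suc (suc n) C i) * bernUpTo n i)))
    ≡⟨ cong (λ z → X + ι (suc (suc n)) * (- ((+ 1 / suc (suc n)) * z)))
         (sumTo-cong-≤ n (λ i i≤n → cong (ι (suc (suc n) C i) *_) (BernoulliTable.stable n i i≤n))) ⟩
  X + ι (suc (suc n)) * (- ((+ 1 / suc (suc n)) * X))
    ≡⟨ solve 3 (λ x a b → x :+ a :* (:- (b :* x)) := x :- (a :* b) :* x) refl X (ι (suc (suc n))) (+ 1 / suc (suc n)) ⟩
  X - (ι (suc (suc n)) * (+ 1 / suc (suc n))) * X
    ≡⟨ cong (λ z → X - z * X) (ι-inverse (suc n)) ⟩
  X - 1ℚ * X
    ≡⟨ solve 1 (λ x → x :- con 1ℚ :* x := con 0ℚ) refl X ⟩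
  0ℚ ∎
  where
  X = sumTo n (λ i → ι (suc (suc n) C i) * bernoulli i)
  C[n+2,n+1] : suc (suc n) C suc n ≡ suc (suc n)
  C[n+2,n+1] = trans (nCk≡nC[n∸k] (ℕP.n≤1+n (suc n)))
    (trans (cong (suc (suc n) C_) (ℕP.m+n∸n≡m 1 (suc n))) (nC1≡n (suc (suc n))))

-- (eᵗ − 1)·B(t) = t: translating B by 1 adds δ₁.
bernoulli-translate : ∀ m → translate 1ℚ bernoulli m ≡ bernoulli m + δ₁ m
bernoulli-translate zero          = refl
bernoulli-translate (suc zero)    = refl
bernoulli-translate (suc (suc n)) = begin
  translate 1ℚ bernoulli (suc (suc n))
    ≡⟨ translate-closed 1ℚ (suc (suc n)) bernoulli ⟩
  sumTo (suc n) (λ j → binomial 1ℚ (suc (suc n)) j * bernoulli j) + binomial 1ℚ (suc (suc n)) (suc (suc n)) * bernoulli (suc (suc n))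
    ≡⟨ cong₂ (λ x w → x + w * bernoulli (suc (suc n)))
         (trans (sumTo-cong-≤ (suc n) (λ j _ → cong (_* bernoulli j) (binomial-1 (suc (suc n)) j))) (bernoulli-recurrence n))
         (binomial-1-top (suc (suc n))) ⟩
  0ℚ + 1ℚ * bernoulli (suc (suc n))
    ≡⟨ solve 1 (λ b → con 0ℚ :+ con 1ℚ :* b := b :+ con 0ℚ) refl (bernoulli (suc (suc n))) ⟩
  bernoulli (suc (suc n)) + 0ℚ ∎

bernoulli-translate-suc : ∀ r m → translate (r + 1ℚ) bernoulli m ≡ translate r bernoulli m + timesT (geom r) m
bernoulli-translate-suc r m = begin
  translate (r + 1ℚ) bernoulli m                        ≡⟨ sym (translate-comp r 1ℚ m bernoulli) ⟩
  translate r (translate 1ℚ bernoulli) m                ≡⟨ translate-cong r m bernoulli-translate ⟩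
  translate r (λ k → bernoulli k + δ₁ k) m              ≡⟨ additive (translate-linear r m) bernoulli δ₁ ⟩
  translate r bernoulli m + translate r δ₁ m            ≡⟨ cong (λ x → translate r bernoulli m + x) (translate-δ₁ r m) ⟩
  translate r bernoulli m + timesT (geom r) m           ∎

bernoulli-translate-2 : ∀ m → translate (ι 2) bernoulli m ≡ bernoulli m + δ₁ m + timesT (geom 1ℚ) m
bernoulli-translate-2 m = trans (bernoulli-translate-suc 1ℚ m) (cong (_+ timesT (geom 1ℚ) m) (bernoulli-translate m))

bernoulli-translate-4 : ∀ m → translate (ι 4) bernoulli m
  ≡ bernoulli m + δ₁ m + timesT (geom 1ℚ) m + timesT (geom (ι 2)) m + timesT (geom (ι 3)) m
bernoulli-translate-4 m =
  trans (bernoulli-translate-suc (ι 3) m) (cong (_+ timesT (geom (ι 3)) m)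
    (trans (bernoulli-translate-suc (ι 2) m) (cong (_+ timesT (geom (ι 2)) m) (bernoulli-translate-2 m))))

module EulerTable = Tabulated eulerUpTo
  (λ n → - sumTo n (λ i → ι (suc n C i) * evenInd (suc n ∸ i) * eulerUpTo n i))
  (λ n j → refl)

euler-recurrence : ∀ m → sumTo m (λ j → ι (m C j) * evenInd (m ∸ j) * euler j) ≡ δ₀ m
euler-recurrence zero    = refl
euler-recurrence (suc n) = begin
  X + ι (suc n C suc n) * evenInd (n ∸ n) * euler (suc n)
    ≡⟨ cong₂ (λ c e → X + ι c * evenInd e * euler (suc n)) (nCn≡1 (suc n)) (ℕP.n∸n≡0 n) ⟩
  X + 1ℚ * 1ℚ * euler (suc n)
    ≡⟨ cong (λ z → X + 1ℚ * 1ℚ * z) (trans (EulerTable.top n) (cong -_ (sumTo-cong-≤ n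
         (λ i i≤n → cong (ι (suc n C i) * evenInd (suc n ∸ i) *_) (EulerTable.stable n i i≤n))))) ⟩
  X + 1ℚ * 1ℚ * (- X)
    ≡⟨ solve 1 (λ x → x :+ con 1ℚ :* con 1ℚ :* (:- x) := con 0ℚ) refl X ⟩
  0ℚ ∎
  where X = sumTo n (λ j → ι (suc n C j) * evenInd (suc n ∸ j) * euler j)

parity : ∀ k → pow 1ℚ k + pow (- 1ℚ) k ≡ ι 2 * evenInd k
parity zero          = refl
parity (suc zero)    = refl
parity (suc (suc k)) = trans
  (solve 2 (λ a b → con 1ℚ :* (con 1ℚ :* a) :+ (:- con 1ℚ) :* ((:- con 1ℚ) :* b) := a :+ b) refl (pow 1ℚ k) (pow (- 1ℚ) k))
  (parity k)

-- (eᵗ + e⁻ᵗ)·E(t) = 2.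
euler-translate : ∀ m → translate 1ℚ euler m + translate (- 1ℚ) euler m ≡ ι 2 * δ₀ m
euler-translate m = begin
  translate 1ℚ euler m + translate (- 1ℚ) euler m
    ≡⟨ cong₂ _+_ (translate-closed 1ℚ m euler) (translate-closed (- 1ℚ) m euler) ⟩
  sumTo m (λ j → binomial 1ℚ m j * euler j) + sumTo m (λ j → binomial (- 1ℚ) m j * euler j)
    ≡⟨ sym (additive Σ _ _) ⟩
  sumTo m (λ j → binomial 1ℚ m j * euler j + binomial (- 1ℚ) m j * euler j)
    ≡⟨ cong-≗ Σ even-terms ⟩
  sumTo m (λ j → ι 2 * (ι (m C j) * evenInd (m ∸ j) * euler j))
    ≡⟨ homogeneous Σ (ι 2) _ ⟩
  ι 2 * sumTo m (λ j → ι (m C j) * evenInd (m ∸ j) * euler j)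
    ≡⟨ cong (ι 2 *_) (euler-recurrence m) ⟩
  ι 2 * δ₀ m ∎
  where
  Σ = sumTo-linear m
  even-terms : ∀ j → binomial 1ℚ m j * euler j + binomial (- 1ℚ) m j * euler j
                     ≡ ι 2 * (ι (m C j) * evenInd (m ∸ j) * euler j)
  even-terms j = trans
    (solve 4 (λ c a b e → c :* a :* e :+ c :* b :* e := (a :+ b) :* (c :* e))
       refl (ι (m C j)) (pow 1ℚ (m ∸ j)) (pow (- 1ℚ) (m ∸ j)) (euler j))
    (trans (cong (_* (ι (m C j) * euler j)) (parity (m ∸ j)))
      (solve 4 (λ t v c e → t :* v :* (c :* e) := t :* (c :* v :* e)) refl (ι 2) (evenInd (m ∸ j)) (ι (m C j)) (euler j)))

-- Multiplying by e^(rt): translates by r ± 1 add up to 2rᵐ.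
euler-translate-around : ∀ r m → translate (r + 1ℚ) euler m + translate (r - 1ℚ) euler m ≡ ι 2 * pow r m
euler-translate-around r m = begin
  translate (r + 1ℚ) euler m + translate (r - 1ℚ) euler m
    ≡⟨ sym (cong₂ _+_ (translate-comp r 1ℚ m euler) (translate-comp r (- 1ℚ) m euler)) ⟩
  translate r (translate 1ℚ euler) m + translate r (translate (- 1ℚ) euler) m
    ≡⟨ sym (additive (translate-linear r m) _ _) ⟩
  translate r (λ k → translate 1ℚ euler k + translate (- 1ℚ) euler k) m
    ≡⟨ translate-cong r m euler-translate ⟩
  translate r (λ k → ι 2 * δ₀ k) m
    ≡⟨ homogeneous (translate-linear r m) (ι 2) δ₀ ⟩
  ι 2 * translate r δ₀ m
    ≡⟨ cong (ι 2 *_) (translate-δ₀ r m) ⟩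
  ι 2 * pow r m ∎

-- E translated by 4, from the cases r = 3 and r = 1.
euler-translate-4 : ∀ m → translate (ι 4) euler m ≡ euler m + (ι 2 * pow (ι 3) m - ι 2 * pow 1ℚ m)
euler-translate-4 m = begin
  translate (ι 4) euler m
    ≡⟨ solve 3 (λ a b e → a := (a :+ b) :- (b :+ e) :+ e) refl (translate (ι 4) euler m) (translate (ι 2) euler m) (euler m) ⟩
  (translate (ι 4) euler m + translate (ι 2) euler m) - (translate (ι 2) euler m + euler m) + euler m
    ≡⟨ cong₂ (λ x y → x - (translate (ι 2) euler m + y) + euler m) (euler-translate-around (ι 3) m) (sym (translate-zero m euler)) ⟩
  ι 2 * pow (ι 3) m - (translate (ι 2) euler m + translate 0ℚ euler m) + euler m
    ≡⟨ cong (λ x → ι 2 * pow (ι 3) m - x + euler m) (euler-translate-around 1ℚ m) ⟩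
  ι 2 * pow (ι 3) m - ι 2 * pow 1ℚ m + euler m
    ≡⟨ ℚP.+-comm _ (euler m) ⟩
  euler m + (ι 2 * pow (ι 3) m - ι 2 * pow 1ℚ m) ∎

-- The ring identity behind the induction step below, with N = 1+M, N₂ = 1+N and
-- A = B′ − M·A′ (an instance of the Stirling recurrence).
shift-step-algebra : ∀ (M A′ Bs B′ : ℚ) {N N₂ A} → N ≡ 1ℚ + M → N₂ ≡ 1ℚ + N → A ≡ B′ - M * A′ →
  ((A + N * A′) + (Bs + N * B′)) - N * (A + N * A′) ≡ (Bs - N * A) + N₂ * A
shift-step-algebra M A′ Bs B′ refl refl refl = solve 4 (λ M A′ Bs B′ →
  (((B′ :- M :* A′) :+ (con 1ℚ :+ M) :* A′) :+ (Bs :+ (con 1ℚ :+ M) :* B′))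
    :- (con 1ℚ :+ M) :* ((B′ :- M :* A′) :+ (con 1ℚ :+ M) :* A′)
  := (Bs :- (con 1ℚ :+ M) :* (B′ :- M :* A′)) :+ (con 1ℚ :+ (con 1ℚ :+ M)) :* (B′ :- M :* A′)) refl M A′ Bs B′

-- L_(translate 1 d)((x)_(n+1)) = L_d((x+1)_(n+1)) = L_d((x)_(n+1)) + (n+1)·L_d((x)ₙ).
stirlingSum-translate : ∀ n (d : Seq) →
  stirlingSum (suc n) (translate 1ℚ d) ≡ stirlingSum (suc n) d + ι (suc n) * stirlingSum n d
stirlingSum-translate zero d = begin
  stirlingSum 1 (translate 1ℚ d)
    ≡⟨ stirlingSum-rec 0 (translate 1ℚ d) ⟩
  stirlingSum 0 (translate 1ℚ d ⁺) - ι 0 * stirlingSum 0 (translate 1ℚ d)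
    ≡⟨ solve 2 (λ x y → con 1ℚ :* (con 1ℚ :* x :+ y) :- con 0ℚ :* (con 1ℚ :* x)
                     := (con 1ℚ :* y :- con 0ℚ :* (con 1ℚ :* x)) :+ con 1ℚ :* (con 1ℚ :* x)) refl (d 0) (d 1) ⟩
  (stirlingSum 0 (d ⁺) - ι 0 * stirlingSum 0 d) + ι 1 * stirlingSum 0 d
    ≡⟨ cong (_+ ι 1 * stirlingSum 0 d) (sym (stirlingSum-rec 0 d)) ⟩
  stirlingSum 1 d + ι 1 * stirlingSum 0 d ∎
stirlingSum-translate (suc m) d = begin
  stirlingSum (suc (suc m)) (translate 1ℚ d)
    ≡⟨ stirlingSum-rec (suc m) (translate 1ℚ d) ⟩
  stirlingSum (suc m) (translate 1ℚ d ⁺) - N * stirlingSum (suc m) (translate 1ℚ d)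
    ≡⟨ cong (_- N * stirlingSum (suc m) (translate 1ℚ d)) split ⟩
  (stirlingSum (suc m) (translate 1ℚ d) + stirlingSum (suc m) (translate 1ℚ (d ⁺))) - N * stirlingSum (suc m) (translate 1ℚ d)
    ≡⟨ cong₂ (λ x y → (x + y) - N * x) (stirlingSum-translate m d) (stirlingSum-translate m (d ⁺)) ⟩
  ((A + N * A′) + (Bs + N * B′)) - N * (A + N * A′)
    ≡⟨ shift-step-algebra (ι m) A′ Bs B′ (ι-suc m) (ι-suc (suc m)) (stirlingSum-rec m d) ⟩
  (Bs - N * A) + ι (suc (suc m)) * A
    ≡⟨ cong (_+ ι (suc (suc m)) * A) (sym (stirlingSum-rec (suc m) d)) ⟩
  stirlingSum (suc (suc m)) d + ι (suc (suc m)) * A ∎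
  where
  N  = ι (suc m)
  A  = stirlingSum (suc m) d
  A′ = stirlingSum m d
  Bs = stirlingSum (suc m) (d ⁺)
  B′ = stirlingSum m (d ⁺)
  split : stirlingSum (suc m) (translate 1ℚ d ⁺)
          ≡ stirlingSum (suc m) (translate 1ℚ d) + stirlingSum (suc m) (translate 1ℚ (d ⁺))
  split = trans (cong-≗ (stirlingSum-linear (suc m)) (λ k → cong (_+ translate 1ℚ (d ⁺) k) (ℚP.*-identityˡ (translate 1ℚ d k))))
                (additive (stirlingSum-linear (suc m)) _ _)

difference-lemma : ∀ n (c e : Seq) → (∀ k → translate 1ℚ c k ≡ c k + e k) →
  stirlingSum n c ≡ stirlingSum (suc n) e * (+ 1 / suc n)
difference-lemma n c e c-shift = divide-by-suc n (+-cancelˡ (stirlingSum (suc n) c) _ _ (begin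
  stirlingSum (suc n) c + ι (suc n) * stirlingSum n c   ≡⟨ sym (stirlingSum-translate n c) ⟩
  stirlingSum (suc n) (translate 1ℚ c)                  ≡⟨ cong-≗ (stirlingSum-linear (suc n)) c-shift ⟩
  stirlingSum (suc n) (λ k → c k + e k)                 ≡⟨ additive (stirlingSum-linear (suc n)) c e ⟩
  stirlingSum (suc n) c + stirlingSum (suc n) e         ∎))

-- A translation rule for c follows from the same rule for timesT c, since translation
-- commutes with timesT and timesT is injective in positive degree.
translate-from-timesT : ∀ (c e : Seq) → (∀ m → translate 1ℚ (timesT c) m ≡ timesT c m + timesT e m) →
  ∀ m → translate 1ℚ c m ≡ c m + e m
translate-from-timesT c e timesT-shift m = ι-cancel m (begin
  ι (suc m) * translate 1ℚ c m          ≡⟨ sym (translate-timesT 1ℚ (suc m) c) ⟩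
  translate 1ℚ (timesT c) (suc m)       ≡⟨ timesT-shift (suc m) ⟩
  ι (suc m) * c m + ι (suc m) * e m     ≡⟨ sym (ℚP.*-distribˡ-+ (ι (suc m)) (c m) (e m)) ⟩
  ι (suc m) * (c m + e m)               ∎)

c₂ : Seq
c₂ k = (halfPow k - ι 2) * bernoulli (suc k) * (+ 1 / suc k)

-- Multiplying by the index removes the division: k·c₂(k−1) = 2·2⁻ᵏB_k − 2B_k.
timesT-c₂ : ∀ k → timesT c₂ k ≡ ι 2 * dilate ½ bernoulli k - ι 2 * bernoulli k
timesT-c₂ zero    = refl
timesT-c₂ (suc j) = begin
  ι (suc j) * ((H - ι 2) * b * (+ 1 / suc j))
    ≡⟨ solve 4 (λ n h b p → n :* ((h :- con (ι 2)) :* b :* p) := (h :- con (ι 2)) :* b :* (n :* p)) refl (ι (suc j)) H b (+ 1 / suc j) ⟩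
  (H - ι 2) * b * (ι (suc j) * (+ 1 / suc j))
    ≡⟨ cong ((H - ι 2) * b *_) (ι-inverse j) ⟩
  (H - ι 2) * b * 1ℚ
    ≡⟨ solve 2 (λ h b → (h :- con (ι 2)) :* b :* con 1ℚ := con (ι 2) :* ((con ½ :* h) :* b) :- con (ι 2) :* b) refl H b ⟩
  ι 2 * dilate ½ bernoulli (suc j) - ι 2 * b ∎
  where
  H = pow ½ j
  b = bernoulli (suc j)

residual₂ : ∀ m → ι 2 * (pow ½ m * (δ₁ m + timesT (geom 1ℚ) m)) - ι 2 * δ₁ m ≡ timesT (λ k → pow ½ k - δ₀ k) m
residual₂ zero          = refl
residual₂ (suc zero)    = refl
residual₂ (suc (suc j)) = begin
  ι 2 * ((½ * (½ * H)) * (0ℚ + N * (1ℚ * pow 1ℚ j))) - ι 2 * 0ℚ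
    ≡⟨ cong (λ p → ι 2 * ((½ * (½ * H)) * (0ℚ + N * (1ℚ * p))) - ι 2 * 0ℚ) (pow-1 j) ⟩
  ι 2 * ((½ * (½ * H)) * (0ℚ + N * (1ℚ * 1ℚ))) - ι 2 * 0ℚ
    ≡⟨ solve 2 (λ n h → con (ι 2) :* ((con ½ :* (con ½ :* h)) :* (con 0ℚ :+ n :* (con 1ℚ :* con 1ℚ))) :- con (ι 2) :* con 0ℚ
                        := n :* (con ½ :* h :- con 0ℚ)) refl N H ⟩
  N * (½ * H - 0ℚ) ∎
  where
  H = pow ½ j
  N = ι (suc (suc j))

timesT-c₂-translate : ∀ m → translate 1ℚ (timesT c₂) m ≡ timesT c₂ m + timesT (λ k → pow ½ k - δ₀ k) m
timesT-c₂-translate m = begin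
  translate 1ℚ (timesT c₂) m
    ≡⟨ translate-cong 1ℚ m timesT-c₂ ⟩
  translate 1ℚ (λ k → ι 2 * dilate ½ bernoulli k - ι 2 * bernoulli k) m
    ≡⟨ scaled-difference (translate-linear 1ℚ m) (ι 2) (ι 2) (dilate ½ bernoulli) bernoulli ⟩
  ι 2 * translate 1ℚ (dilate ½ bernoulli) m - ι 2 * translate 1ℚ bernoulli m
    ≡⟨ cong₂ (λ x y → ι 2 * x - ι 2 * y) (translate-dilate ½ (ι 2) m bernoulli) (bernoulli-translate m) ⟩
  ι 2 * (pow ½ m * translate (ι 2) bernoulli m) - ι 2 * (B + δ₁ m)
    ≡⟨ cong (λ x → ι 2 * (pow ½ m * x) - ι 2 * (B + δ₁ m)) (bernoulli-translate-2 m) ⟩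
  ι 2 * (pow ½ m * (B + δ₁ m + timesT (geom 1ℚ) m)) - ι 2 * (B + δ₁ m)
    ≡⟨ solve 4 (λ h b d u → con (ι 2) :* (h :* (b :+ d :+ u)) :- con (ι 2) :* (b :+ d)
                           := (con (ι 2) :* (h :* b) :- con (ι 2) :* b) :+ (con (ι 2) :* (h :* (d :+ u)) :- con (ι 2) :* d))
         refl (pow ½ m) B (δ₁ m) (timesT (geom 1ℚ) m) ⟩
  (ι 2 * dilate ½ bernoulli m - ι 2 * B) + (ι 2 * (pow ½ m * (δ₁ m + timesT (geom 1ℚ) m)) - ι 2 * δ₁ m)
    ≡⟨ cong₂ _+_ (sym (timesT-c₂ m)) (residual₂ m) ⟩
  timesT c₂ m + timesT (λ k → pow ½ k - δ₀ k) m ∎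
  where B = bernoulli m

-- The translation rule for c₂: its generating function is 1/(e^(t/2) + 1).
c₂-translate : ∀ m → translate 1ℚ c₂ m ≡ c₂ m + (pow ½ m - δ₀ m)
c₂-translate = translate-from-timesT c₂ (λ k → pow ½ k - δ₀ k) timesT-c₂-translate

c₃ : Seq
c₃ k = ((1ℚ + halfPow (suc k) * (1ℚ - halfPow k)) * bernoulli (suc k)
        + pow ¼ (suc k) * ι (suc k) * euler k) * (+ 1 / suc k)

timesT-c₃ : ∀ k → timesT c₃ k
  ≡ bernoulli k + dilate ½ bernoulli k + (dilate ¼ (timesT euler) k - ι 2 * dilate ¼ bernoulli k)
timesT-c₃ zero    = refl
timesT-c₃ (suc j) = begin
  ι (suc j) * (X * (+ 1 / suc j))
    ≡⟨ solve 3 (λ n x p → n :* (x :* p) := x :* (n :* p)) refl (ι (suc j)) X (+ 1 / suc j) ⟩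
  X * (ι (suc j) * (+ 1 / suc j))
    ≡⟨ cong (X *_) (ι-inverse j) ⟩
  X * 1ℚ
    ≡⟨ solve 5 (λ h b q n e → ((con 1ℚ :+ (con ½ :* h) :* (con 1ℚ :- h)) :* b :+ (con ¼ :* q) :* n :* e) :* con 1ℚ
                            := b :+ (con ½ :* h) :* b :+ ((con ¼ :* q) :* (n :* e) :- con ½ :* (h :* h) :* b)) refl H b Q N E ⟩
  b + (½ * H) * b + ((¼ * Q) * (N * E) - ½ * (H * H) * b)
    ≡⟨ cong (λ z → b + (½ * H) * b + ((¼ * Q) * (N * E) - ½ * z * b)) (pow-* ½ ½ j) ⟩
  b + (½ * H) * b + ((¼ * Q) * (N * E) - ½ * Q * b)
    ≡⟨ cong (λ z → b + (½ * H) * b + ((¼ * Q) * (N * E) - z))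
         (solve 2 (λ q b → con ½ :* q :* b := con (ι 2) :* ((con ¼ :* q) :* b)) refl Q b) ⟩
  bernoulli (suc j) + dilate ½ bernoulli (suc j) + (dilate ¼ (timesT euler) (suc j) - ι 2 * dilate ¼ bernoulli (suc j)) ∎
  where
  H = pow ½ j
  Q = pow ¼ j
  N = ι (suc j)
  E = euler j
  b = bernoulli (suc j)
  X = (1ℚ + halfPow (suc j) * (1ℚ - halfPow j)) * b + pow ¼ (suc j) * N * E

residual₃ : ∀ m →
  δ₁ m + pow ½ m * (δ₁ m + timesT (geom 1ℚ) m)
  + (pow ¼ m * (ι 2 * timesT (geom (ι 3)) m - ι 2 * timesT (geom 1ℚ) m)
     - ι 2 * (pow ¼ m * (δ₁ m + timesT (geom 1ℚ) m + timesT (geom (ι 2)) m + timesT (geom (ι 3)) m)))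
  ≡ timesT (λ k → δ₀ k - pow ¼ k) m
residual₃ zero          = refl
residual₃ (suc zero)    = refl
residual₃ (suc (suc j)) = begin
  0ℚ + (½ * (½ * H)) * (0ℚ + N * (1ℚ * P₁))
  + ((¼ * (¼ * Q)) * (ι 2 * (N * (ι 3 * P₃)) - ι 2 * (N * (1ℚ * P₁)))
     - ι 2 * ((¼ * (¼ * Q)) * (0ℚ + N * (1ℚ * P₁) + N * (ι 2 * P₂) + N * (ι 3 * P₃))))
    ≡⟨ solve 6 (λ h q p₁ p₂ p₃ n →
         con 0ℚ :+ (con ½ :* (con ½ :* h)) :* (con 0ℚ :+ n :* (con 1ℚ :* p₁))
         :+ ((con ¼ :* (con ¼ :* q)) :* (con (ι 2) :* (n :* (con (ι 3) :* p₃)) :- con (ι 2) :* (n :* (con 1ℚ :* p₁)))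
             :- con (ι 2) :* ((con ¼ :* (con ¼ :* q))
                              :* (con 0ℚ :+ n :* (con 1ℚ :* p₁) :+ n :* (con (ι 2) :* p₂) :+ n :* (con (ι 3) :* p₃))))
         := con ¼ :* n :* (h :* p₁ :- q :* p₁ :- q :* p₂)) refl H Q P₁ P₂ P₃ N ⟩
  ¼ * N * (H * P₁ - Q * P₁ - Q * P₂)
    ≡⟨ cong₂ (λ p x → ¼ * N * (H * p - Q * p - x)) (pow-1 j) (pow-* ¼ (ι 2) j) ⟩
  ¼ * N * (H * 1ℚ - Q * 1ℚ - H)
    ≡⟨ solve 3 (λ h q n → con ¼ :* n :* (h :* con 1ℚ :- q :* con 1ℚ :- h) := n :* (con 0ℚ :- con ¼ :* q)) refl H Q N ⟩
  N * (0ℚ - ¼ * Q) ∎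
  where
  H  = pow ½ j
  Q  = pow ¼ j
  P₁ = pow 1ℚ j
  P₂ = pow (ι 2) j
  P₃ = pow (ι 3) j
  N  = ι (suc (suc j))

timesT-euler-translate-4 : ∀ m → translate (ι 4) (timesT euler) m
  ≡ timesT euler m + (ι 2 * timesT (geom (ι 3)) m - ι 2 * timesT (geom 1ℚ) m)
timesT-euler-translate-4 m = begin
  translate (ι 4) (timesT euler) m
    ≡⟨ translate-timesT (ι 4) m euler ⟩
  timesT (translate (ι 4) euler) m
    ≡⟨ cong-≗ L euler-translate-4 ⟩
  timesT (λ k → euler k + (ι 2 * pow (ι 3) k - ι 2 * pow 1ℚ k)) m
    ≡⟨ additive L euler _ ⟩
  timesT euler m + timesT (λ k → ι 2 * pow (ι 3) k - ι 2 * pow 1ℚ k) m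
    ≡⟨ cong (λ x → timesT euler m + x) (scaled-difference L (ι 2) (ι 2) (geom (ι 3)) (geom 1ℚ)) ⟩
  timesT euler m + (ι 2 * timesT (geom (ι 3)) m - ι 2 * timesT (geom 1ℚ) m) ∎
  where L = timesT-linear m

timesT-c₃-translate : ∀ m → translate 1ℚ (timesT c₃) m ≡ timesT c₃ m + timesT (λ k → δ₀ k - pow ¼ k) m
timesT-c₃-translate m = begin
  translate 1ℚ (timesT c₃) m
    ≡⟨ translate-cong 1ℚ m timesT-c₃ ⟩
  translate 1ℚ (λ k → bernoulli k + dilate ½ bernoulli k + (dilate ¼ (timesT euler) k - ι 2 * dilate ¼ bernoulli k)) m
    ≡⟨ trans (additive L _ _) (cong₂ _+_ (additive L _ _)
         (trans (difference L _ _) (cong (λ x → T₁ (dilate ¼ (timesT euler)) - x) (homogeneous L (ι 2) _)))) ⟩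
  T₁ bernoulli + T₁ (dilate ½ bernoulli) + (T₁ (dilate ¼ (timesT euler)) - ι 2 * T₁ (dilate ¼ bernoulli))
    ≡⟨ cong₂ _+_ (cong₂ _+_ (bernoulli-translate m) (translate-dilate ½ (ι 2) m bernoulli))
                 (cong₂ (λ x y → x - ι 2 * y) (translate-dilate ¼ (ι 4) m (timesT euler)) (translate-dilate ¼ (ι 4) m bernoulli)) ⟩
  (B + D) + pow ½ m * translate (ι 2) bernoulli m
    + (pow ¼ m * translate (ι 4) (timesT euler) m - ι 2 * (pow ¼ m * translate (ι 4) bernoulli m))
    ≡⟨ cong₂ (λ x y → (B + D) + pow ½ m * x + y) (bernoulli-translate-2 m)
         (cong₂ (λ x y → pow ¼ m * x - ι 2 * (pow ¼ m * y)) (timesT-euler-translate-4 m) (bernoulli-translate-4 m)) ⟩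
  (B + D) + pow ½ m * (B + D + t₁) + (pow ¼ m * (tE + (ι 2 * t₃ - ι 2 * t₁)) - ι 2 * (pow ¼ m * (B + D + t₁ + t₂ + t₃)))
    ≡⟨ solve 8 (λ b d h q e u₁ u₂ u₃ →
         (b :+ d) :+ h :* (b :+ d :+ u₁)
           :+ (q :* (e :+ (con (ι 2) :* u₃ :- con (ι 2) :* u₁)) :- con (ι 2) :* (q :* (b :+ d :+ u₁ :+ u₂ :+ u₃)))
         := (b :+ h :* b :+ (q :* e :- con (ι 2) :* (q :* b)))
            :+ (d :+ h :* (d :+ u₁) :+ (q :* (con (ι 2) :* u₃ :- con (ι 2) :* u₁) :- con (ι 2) :* (q :* (d :+ u₁ :+ u₂ :+ u₃)))))
         refl B D (pow ½ m) (pow ¼ m) tE t₁ t₂ t₃ ⟩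
  (B + dilate ½ bernoulli m + (dilate ¼ (timesT euler) m - ι 2 * dilate ¼ bernoulli m))
    + (D + pow ½ m * (D + t₁) + (pow ¼ m * (ι 2 * t₃ - ι 2 * t₁) - ι 2 * (pow ¼ m * (D + t₁ + t₂ + t₃))))
    ≡⟨ cong₂ _+_ (sym (timesT-c₃ m)) (residual₃ m) ⟩
  timesT c₃ m + timesT (λ k → δ₀ k - pow ¼ k) m ∎
  where
  L  = translate-linear 1ℚ m
  T₁ : Seq → ℚ
  T₁ d = translate 1ℚ d m
  B  = bernoulli m
  D  = δ₁ m
  tE = timesT euler m
  t₁ = timesT (geom 1ℚ) m
  t₂ = timesT (geom (ι 2)) m
  t₃ = timesT (geom (ι 3)) m

c₃-translate : ∀ m → translate 1ℚ c₃ m ≡ c₃ m + (δ₀ m - pow ¼ m)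
c₃-translate = translate-from-timesT c₃ (λ k → δ₀ k - pow ¼ k) timesT-c₃-translate

identity₁ : ∀ n → stirlingSum n bernoulli ≡ sgn n * ι (n !) * (+ 1 / suc n)
identity₁ n = begin
  stirlingSum n bernoulli                       ≡⟨ difference-lemma n bernoulli δ₁ bernoulli-translate ⟩
  stirlingSum (suc n) δ₁ * (+ 1 / suc n)        ≡⟨ cong (_* (+ 1 / suc n)) (stirlingSum-δ₁ n) ⟩
  sgn n * ι (n !) * (+ 1 / suc n)               ∎

identity₂ : ∀ n → stirlingSum n c₂ ≡ sgn n * (+ 1 / suc n) * (ι (oddProd n) * halfPow (suc n))
identity₂ n = begin
  stirlingSum n c₂
    ≡⟨ difference-lemma n c₂ _ c₂-translate ⟩
  stirlingSum (suc n) (λ k → pow ½ k - δ₀ k) * (+ 1 / suc n)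
    ≡⟨ cong (_* (+ 1 / suc n)) (difference (stirlingSum-linear (suc n)) (geom ½) δ₀) ⟩
  (stirlingSum (suc n) (geom ½) - stirlingSum (suc n) δ₀) * (+ 1 / suc n)
    ≡⟨ cong₂ (λ x y → (x - y) * (+ 1 / suc n)) (trans (stirlingSum-geom ½ (suc n)) (falling-½ n)) (stirlingSum-δ₀ n) ⟩
  (sgn n * F - 0ℚ) * (+ 1 / suc n)
    ≡⟨ solve 3 (λ g f p → (g :* f :- con 0ℚ) :* p := g :* p :* f) refl (sgn n) F (+ 1 / suc n) ⟩
  sgn n * (+ 1 / suc n) * F ∎
  where F = ι (oddProd n) * halfPow (suc n)

identity₃ : ∀ n → stirlingSum n c₃ ≡ sgn (suc n) * (+ 1 / 4) * (+ 1 / suc n) * rising (+ 3 / 4) n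
identity₃ n = begin
  stirlingSum n c₃
    ≡⟨ difference-lemma n c₃ _ c₃-translate ⟩
  stirlingSum (suc n) (λ k → δ₀ k - pow ¼ k) * (+ 1 / suc n)
    ≡⟨ cong (_* (+ 1 / suc n)) (difference (stirlingSum-linear (suc n)) δ₀ (geom ¼)) ⟩
  (stirlingSum (suc n) δ₀ - stirlingSum (suc n) (geom ¼)) * (+ 1 / suc n)
    ≡⟨ cong₂ (λ x y → (x - y) * (+ 1 / suc n)) (stirlingSum-δ₀ n) (trans (stirlingSum-geom ¼ (suc n)) (falling-¼ n)) ⟩
  (0ℚ - sgn n * ¼ * R) * (+ 1 / suc n)
    ≡⟨ solve 3 (λ g r p → (con 0ℚ :- g :* con ¼ :* r) :* p := (:- con 1ℚ :* g) :* con ¼ :* p :* r) refl (sgn n) R (+ 1 / suc n) ⟩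
  sgn (suc n) * ¼ * (+ 1 / suc n) * R ∎
  where R = rising (+ 3 / 4) n

theorem1 : (n : ℕ) →
  (sumTo n (λ k → s n k * bernoulli k)
     ≡ sgn n * ι (n !) * (+ 1 / suc n))
  × (sumTo n (λ k → s n k * ((halfPow k - ι 2) * bernoulli (suc k) * (+ 1 / suc k)))
     ≡ sgn n * (+ 1 / suc n) * (ι (oddProd n) * halfPow (suc n)))
  × (sumTo n (λ k → s n k * (((1ℚ + halfPow (suc k) * (1ℚ - halfPow k)) * bernoulli (suc k)
                              + pow (+ 1 / 4) (suc k) * ι (suc k) * euler k) * (+ 1 / suc k)))
     ≡ sgn (suc n) * (+ 1 / 4) * (+ 1 / suc n) * rising (+ 3 / 4) n)
theorem1 n = identity₁ n , identity₂ n , identity₃ n
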